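{- Let $k$ be a field. For every integer $n \geq 225$ and every even integer $2m$ with $0 \leq 2m \leq n^{2} - \frac{9}{2}n\sqrt{n}$, the matrix algebra $\mathrm{M}_{n}(k)$ contains a connected semi-simple subalgebra of dimension $n + 2m$.
   Context: $\mathrm{M}_{n}(k)$ denotes the $k$-algebra of all $n\times n$ matrices over $k$. A connected semi-simple subalgebra (CSA) of $\mathrm{M}_{n}(k)$ is a subalgebra isomorphic to a direct sum $\bigoplus_{i=1}^{t}\mathrm{M}_{n_i}(k)$ of full matrix algebras with $n_1+\cdots+n_t = n$ (for instance, the algebra of block-diagonal matrices whose diagonal blocks are arbitrary $n_i\times n_i$ matrices); its dimension as a $k$-vector space is $\sum_{i} n_i^{2}$. -}

module Defs where

open import Level using (Level; _⊔_)
open import Data.Nat as ℕ using (ℕ; suc; _≤_; _∸_)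
open import Data.Fin using (Fin)
import Data.Fin as Fin
open import Relation.Binary.PropositionalEquality using (_≡_)
open import Relation.Nullary using (yes; no)
open import Data.Product using (Σ; ∃; _×_)
open import Relation.Nullary using (¬_)
open import Algebra.Bundles using (CommutativeRing)
import Algebra.Properties.Monoid.Sum as MSum

record Field (c ℓ : Level) : Set (Level.suc (c ⊔ ℓ)) where
  field
    commRing : CommutativeRing c ℓ
  open CommutativeRing commRing public
  field
    0≉1     : ¬ (0# ≈ 1#)
    inverse : ∀ x → ¬ (x ≈ 0#) → Σ Carrier λ y → (x * y) ≈ 1#

∑ℕ : ∀ {t} → (Fin t → ℕ) → ℕ
∑ℕ {ℕ.zero}  f = 0
∑ℕ {suc t} f = f Fin.zero ℕ.+ ∑ℕ (λ i → f (Fin.suc i))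

module MatrixAlgebra {c ℓ} (k : Field c ℓ) where
  open Field k
  open MSum +-monoid using (sum)

  Mat : ℕ → Set c
  Mat n = Fin n → Fin n → Carrier

  _≈M_ : ∀ {n} → Mat n → Mat n → Set ℓ
  A ≈M B = ∀ i j → A i j ≈ B i j

  _+M_ : ∀ {n} → Mat n → Mat n → Mat n
  (A +M B) i j = A i j + B i j

  _·M_ : ∀ {n} → Carrier → Mat n → Mat n
  (a ·M A) i j = a * A i j

  _*M_ : ∀ {n} → Mat n → Mat n → Mat n
  _*M_ {n} A B i j = sum {n} (λ l → A i l * B l j)

  1M : ∀ {n} → Mat n
  1M i j with i Fin.≟ j
  ... | yes _ = 1#
  ... | no  _ = 0#

  DSum : ∀ {t} → (Fin t → ℕ) → Set c
  DSum ns = ∀ i → Mat (ns i)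

  _≈D_ : ∀ {t} {ns : Fin t → ℕ} → DSum ns → DSum ns → Set ℓ
  x ≈D y = ∀ i → x i ≈M y i

  -- An injective (unital) k-algebra homomorphism ⊕ M_{ns i}(k) → M_n(k);
  -- its image is a subalgebra of M_n(k) isomorphic to ⊕ M_{ns i}(k).
  record IsAlgebraEmbedding {t n} (ns : Fin t → ℕ) (φ : DSum ns → Mat n) : Set (c ⊔ ℓ) where
    field
      cong      : ∀ x y → x ≈D y → φ x ≈M φ y
      injective : ∀ x y → φ x ≈M φ y → x ≈D y
      hom-+     : ∀ x y → φ (λ i → x i +M y i) ≈M (φ x +M φ y)
      hom-·     : ∀ a x → φ (λ i → a ·M x i) ≈M (a ·M φ x)
      hom-*     : ∀ x y → φ (λ i → x i *M y i) ≈M (φ x *M φ y)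
      hom-1     : φ (λ i → 1M) ≈M 1M

  -- A connected semi-simple subalgebra of M_n(k) of dimension d: a subalgebra
  -- (image of an algebra embedding) isomorphic to ⊕_{i<t} M_{n_i}(k) with
  -- n_i ≥ 1, n_1+…+n_t = n, and dimension d = ∑ n_i².
  record CSA (n d : ℕ) : Set (c ⊔ ℓ) where
    field
      t        : ℕ
      sizes    : Fin t → ℕ
      positive : ∀ i → 1 ≤ sizes i
      sum-n    : ∑ℕ sizes ≡ n
      dim-d    : ∑ℕ (λ i → sizes i ℕ.* sizes i) ≡ d
      embed    : DSum sizes → Mat n
      isEmbed  : IsAlgebraEmbedding sizes embed

module Submission where

-- Block sizes s₁, …, s_t summing to n give, through block-diagonal matrices, a
-- connected semi-simple subalgebra of dimension Σ sᵢ² = n + Σ sᵢ (sᵢ − 1).  So it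
-- suffices to write 2m as a sum of oblong numbers c (c + 1) whose blocks c + 1 have
-- total size at most n, padding with blocks of size 1.  Greedily take the largest
-- triangular number T(c) ≤ m; the hypothesis on n makes the remainder r ≤ c and
-- the room B = n − (c + 1) satisfy 5 r + 4 B ≤ B², and greedy steps preserve this
-- condition as long as B ≥ 42; smaller B are checked by computation.

open import Defs
open import Level using (Level)

module BlockPartition where

  open import Data.Bool using (if_then_else_)
  open import Data.Fin using (Fin)
  open import Data.List using (List; []; _∷_; _++_; replicate; length; lookup)
  open import Data.Nat
  open import Data.Nat.Induction using (<-wellFounded)
  open import Data.Nat.Properties
  open import Data.Nat.Tactic.RingSolver using (solve-∀)
  open import Data.Product using (_×_; proj₁; proj₂)
  open import Function using (_$_)
  open import Induction.WellFounded using (Acc; acc)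
  open import Relation.Binary.PropositionalEquality
  open import Relation.Nullary using (Dec; yes; no; contradiction)
  open import Relation.Nullary.Decidable using (_→-dec_; _×-dec_; toWitness)

  oblong-suc : ∀ c → suc c * suc (suc c) ≡ c * suc c + 2 * suc c
  oblong-suc = solve-∀

  record TriangularRoot (r : ℕ) : Set where
    field
      root          : ℕ
      triangle      : ℕ
      root-oblong   : root * suc root ≡ 2 * triangle
      triangle≤     : triangle ≤ r
      <nextTriangle : r < triangle + suc root

  open TriangularRoot

  triangularRoot : ∀ r → TriangularRoot r
  triangularRoot zero = record
    { root = 0 ; triangle = 0 ; root-oblong = refl ; triangle≤ = z≤n ; <nextTriangle = s≤s z≤n }
  triangularRoot (suc r) with triangularRoot r
  ... | R with suc r <? triangle R + suc (root R)
  ...   | yes r<next = record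
    { root = root R ; triangle = triangle R ; root-oblong = root-oblong R
    ; triangle≤ = m≤n⇒m≤1+n (triangle≤ R) ; <nextTriangle = r<next }
  ...   | no r≮next = record
    { root = suc c ; triangle = t + suc c ; root-oblong = next-oblong
    ; triangle≤ = ≤-reflexive (sym r≡next) ; <nextTriangle = r<next' }
    where
    c t : ℕ
    c = root R
    t = triangle R
    r≡next : suc r ≡ t + suc c
    r≡next = ≤-antisym (<nextTriangle R) (≮⇒≥ r≮next)
    open ≡-Reasoning
    next-oblong : suc c * suc (suc c) ≡ 2 * (t + suc c)
    next-oblong = begin
      suc c * suc (suc c)   ≡⟨ oblong-suc c ⟩
      c * suc c + 2 * suc c ≡⟨ cong (_+ 2 * suc c) (root-oblong R) ⟩
      2 * t + 2 * suc c     ≡⟨ *-distribˡ-+ 2 t (suc c) ⟨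
      2 * (t + suc c)       ∎
    r<next' : suc r < t + suc c + suc (suc c)
    r<next' = subst (_< t + suc c + suc (suc c)) (sym r≡next) (m<m+n (t + suc c) z<s)

  remainder≤root : ∀ {r} (R : TriangularRoot r) → r ∸ triangle R ≤ root R
  remainder≤root {r} R = begin
    r ∸ t             ≤⟨ ∸-monoˡ-≤ t (s≤s⁻¹ (subst (suc r ≤_) (+-suc t c) (<nextTriangle R))) ⟩
    t + c ∸ t         ≡⟨ m+n∸m≡n t c ⟩
    c                 ∎
    where
    open ≤-Reasoning
    c t : ℕ
    c = root R
    t = triangle R

  -- A list cs stands for blocks of sizes suc c (c ∈ cs); such a block contributes
  -- (suc c)² = suc c + c * suc c to the dimension.
  size : List ℕ → ℕ
  size []       = 0
  size (c ∷ cs) = suc c + size cs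

  oblongs : List ℕ → ℕ
  oblongs []       = 0
  oblongs (c ∷ cs) = c * suc c + oblongs cs

  record Partition≤ (B v : ℕ) : Set where
    field
      parts    : List ℕ
      size≤    : size parts ≤ B
      oblongs≡ : oblongs parts ≡ v

  prependRoot : ∀ {r B} (R : TriangularRoot r) → suc (root R) ≤ B →
                Partition≤ (B ∸ suc (root R)) (2 * (r ∸ triangle R)) → Partition≤ B (2 * r)
  prependRoot {r} {B} R c<B P = record
    { parts    = c ∷ parts
    ; size≤    = ≤-trans (+-monoʳ-≤ (suc c) size≤) (≤-reflexive (m+[n∸m]≡n c<B))
    ; oblongs≡ = begin
        c * suc c + oblongs parts       ≡⟨ cong₂ _+_ (root-oblong R) oblongs≡ ⟩
        2 * t + 2 * (r ∸ t)             ≡⟨ *-distribˡ-+ 2 t (r ∸ t) ⟨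
        2 * (t + (r ∸ t))               ≡⟨ cong (2 *_) (m+[n∸m]≡n (triangle≤ R)) ⟩
        2 * r                           ∎
    }
    where
    open Partition≤ P
    open ≡-Reasoning
    c t : ℕ
    c = root R
    t = triangle R

  record Admissible (B r : ℕ) : Set where
    constructor admissible
    field
      bound : 5 * r + 4 * B ≤ B * B

  open Admissible

  admissible-mono : ∀ {B q r} → q ≤ r → Admissible B r → Admissible B q
  admissible-mono {B} q≤r (admissible adm) =
    admissible (≤-trans (+-monoˡ-≤ (4 * B) (*-monoʳ-≤ 5 q≤r)) adm)

  admissible⇒≤ : ∀ {B r} → Admissible B r → r ≤ B * B
  admissible⇒≤ {B} {r} (admissible adm) = ≤-trans (≤-trans (m≤n*m r 5) (m≤m+n (5 * r) (4 * B))) adm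

  -- Witnesses for small budgets come from the greedy algorithm, written with
  -- the builtin comparison ≤ᵇ so that the finite check below runs quickly.
  largestOblong≤ : ℕ → ℕ → ℕ → ℕ
  largestOblong≤ zero    c v = c
  largestOblong≤ (suc f) c v = if suc c * suc (suc c) ≤ᵇ v then largestOblong≤ f (suc c) v else c

  greedy : ℕ → ℕ → List ℕ
  greedy zero     _         = []
  greedy (suc _)  zero      = []
  greedy (suc f)  r@(suc _) = c ∷ greedy f (r ∸ c * suc c / 2)
    where
    c : ℕ
    c = largestOblong≤ r 0 (2 * r)

  GreedyFits : ℕ → ℕ → Set
  GreedyFits B r = 5 * r + 4 * B ≤ B * B → size (greedy B r) ≤ B × oblongs (greedy B r) ≡ 2 * r

  greedyFits? : ∀ B r → Dec (GreedyFits B r)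
  greedyFits? B r =
    (5 * r + 4 * B ≤? B * B) →-dec ((size (greedy B r) ≤? B) ×-dec (oblongs (greedy B r) ≟ 2 * r))

  greedyFits-below42 : ∀ {B} → B < 42 → ∀ {r} → r < suc (B * B) → GreedyFits B r
  greedyFits-below42 = toWitness {a? = allUpTo? (λ B → allUpTo? (greedyFits? B) (suc (B * B))) 42} _

  partition≤-below42 : ∀ {B r} → B < 42 → Admissible B r → Partition≤ B (2 * r)
  partition≤-below42 {B} {r} B<42 adm = record
    { parts = greedy B r ; size≤ = proj₁ fits ; oblongs≡ = proj₂ fits }
    where
    fits : size (greedy B r) ≤ B × oblongs (greedy B r) ≡ 2 * r
    fits = greedyFits-below42 B<42 (s≤s (admissible⇒≤ adm)) (bound adm)

  *-self-cancel-< : ∀ {m n} → m * m < n * n → m < n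
  *-self-cancel-< {m} {n} m²<n² with m <? n
  ... | yes m<n = m<n
  ... | no  m≮n = contradiction (*-mono-≤ (≮⇒≥ m≮n) (≮⇒≥ m≮n)) (<⇒≱ m²<n²)

  -- Expanding both sides leaves 9 (c − 1)² + 144 B − 45 > 0.
  square<oblongs : ∀ B c → 1 ≤ B → 9 * ((3 * c + 2) * (3 * c + 2)) < 18 * (5 * (c * suc c) + 8 * B)
  square<oblongs (suc b) zero    _ = ≤-trans (m≤m+n _ (107 + 144 * b)) (≤-reflexive (identity b))
    where
    identity : ∀ b → suc (9 * ((3 * 0 + 2) * (3 * 0 + 2))) + (107 + 144 * b) ≡ 18 * (5 * 0 + 8 * (1 + b))
    identity = solve-∀
  square<oblongs (suc b) (suc d) _ =
    ≤-trans (m≤m+n _ (9 * (d * d) + 98 + 144 * b)) (≤-reflexive (identity d b))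
    where
    identity : ∀ d b → suc (9 * ((3 * (1 + d) + 2) * (3 * (1 + d) + 2))) + (9 * (d * d) + 98 + 144 * b)
                       ≡ 18 * (5 * ((1 + d) * (2 + d)) + 8 * (1 + b))
    identity = solve-∀

  rootBlock≤ : ∀ {B r} (R : TriangularRoot r) → 1 ≤ B → Admissible B r → 3 * suc (root R) ≤ 2 * B
  rootBlock≤ {B} {r} R 1≤B adm =
    subst (_≤ 2 * B) (sym (triple c)) (*-self-cancel-< (*-cancelˡ-< 9 _ _ (begin-strict
    9 * ((3 * c + 2) * (3 * c + 2))  <⟨ square<oblongs B c 1≤B ⟩
    18 * (5 * (c * suc c) + 8 * B)   ≡⟨ cong (λ x → 18 * (5 * x + 8 * B)) (root-oblong R) ⟩
    18 * (5 * (2 * t) + 8 * B)       ≡⟨ regroup t B ⟩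
    36 * (5 * t + 4 * B)             ≤⟨ *-monoʳ-≤ 36 (+-monoˡ-≤ (4 * B) (*-monoʳ-≤ 5 (triangle≤ R))) ⟩
    36 * (5 * r + 4 * B)             ≤⟨ *-monoʳ-≤ 36 (bound adm) ⟩
    36 * (B * B)                     ≡⟨ double B ⟩
    9 * ((2 * B) * (2 * B))          ∎)))
    where
    open ≤-Reasoning
    c t : ℕ
    c = root R
    t = triangle R
    regroup : ∀ t B → 18 * (5 * (2 * t) + 8 * B) ≡ 36 * (5 * t + 4 * B)
    regroup = solve-∀
    double : ∀ B → 36 * (B * B) ≡ 9 * ((2 * B) * (2 * B))
    double = solve-∀
    triple : ∀ c → 3 * suc c ≡ suc (3 * c + 2)
    triple = solve-∀

  admissible-afterBlock : ∀ {c u} → 42 ≤ suc c + u → 3 * suc c ≤ 2 * (suc c + u) → Admissible u c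
  admissible-afterBlock {c} {u} 42≤B 3c≤2B = admissible $
    ≤-trans (m≤m+n _ 5) (+-cancelʳ-≤ u _ _ (≤-trans (≤-reflexive (spread c u)) 5B≤u²+u))
    where
    open ≤-Reasoning
    split : ∀ B → 9 * (5 * B) ≡ 42 * B + 3 * B
    split = solve-∀
    factor : ∀ u → 3 * u * (3 * u) + 3 * (3 * u) ≡ 9 * (u * u + u)
    factor = solve-∀
    spread : ∀ c u → 5 * c + 4 * u + 5 + u ≡ 5 * (suc c + u)
    spread = solve-∀
    B : ℕ
    B = suc c + u
    c<2u : suc c ≤ 2 * u
    c<2u = +-cancelˡ-≤ (2 * suc c) _ _ (begin
      2 * suc c + suc c  ≡⟨ +-comm (2 * suc c) (suc c) ⟩
      3 * suc c          ≤⟨ 3c≤2B ⟩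
      2 * B              ≡⟨ *-distribˡ-+ 2 (suc c) u ⟩
      2 * suc c + 2 * u  ∎)
    B≤3u : B ≤ 3 * u
    B≤3u = ≤-trans (+-monoˡ-≤ u c<2u) (≤-reflexive (+-comm (2 * u) u))
    5B≤u²+u : 5 * B ≤ u * u + u
    5B≤u²+u = *-cancelˡ-≤ 9 (begin
      9 * (5 * B)                    ≡⟨ split B ⟩
      42 * B + 3 * B                 ≤⟨ +-mono-≤ (*-monoˡ-≤ B 42≤B) (*-monoʳ-≤ 3 B≤3u) ⟩
      B * B + 3 * (3 * u)            ≤⟨ +-monoˡ-≤ (3 * (3 * u)) (*-mono-≤ B≤3u B≤3u) ⟩
      3 * u * (3 * u) + 3 * (3 * u)  ≡⟨ factor u ⟩
      9 * (u * u + u)                ∎)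

  representable : ∀ B {r} → Admissible B r → Partition≤ B (2 * r)
  representable B = go (<-wellFounded B)
    where
    go : ∀ {B} → Acc _<_ B → ∀ {r} → Admissible B r → Partition≤ B (2 * r)
    go {B} (acc rec) {r} adm with B <? 42
    ... | yes B<42 = partition≤-below42 B<42 adm
    ... | no  B≮42 = prependRoot R c<B (go (rec u<B) (admissible-mono (remainder≤root R) adm′))
      where
      R : TriangularRoot r
      R = triangularRoot r
      c : ℕ
      c = root R
      42≤B : 42 ≤ B
      42≤B = ≮⇒≥ B≮42
      3c≤2B : 3 * suc c ≤ 2 * B
      3c≤2B = rootBlock≤ R (≤-trans (s≤s z≤n) 42≤B) adm
      c<B : suc c ≤ B
      c<B = *-cancelˡ-≤ 3 (≤-trans 3c≤2B (*-monoˡ-≤ B (n≤1+n 2)))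
      u<B : B ∸ suc c < B
      u<B = ∸-monoʳ-< z<s c<B
      B≡ : B ≡ suc c + (B ∸ suc c)
      B≡ = sym (m+[n∸m]≡n c<B)
      adm′ : Admissible (B ∸ suc c) c
      adm′ = admissible-afterBlock (subst (42 ≤_) B≡ 42≤B)
                                   (subst (λ b → 3 * suc c ≤ 2 * b) B≡ 3c≤2B)

  oblong≤square⇒< : ∀ {c n} → 1 ≤ n → c * suc c ≤ n * n → c < n
  oblong≤square⇒< {c} {n} 1≤n oblong≤n² with c <? n
  ... | yes c<n = c<n
  ... | no  c≮n = contradiction (≤-trans (*-mono-≤ n≤c (s≤s n≤c)) oblong≤n²) (<⇒≱ n²<n·n+1)
    where
    instance
      _ : NonZero n
      _ = >-nonZero 1≤n
    n≤c : n ≤ c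
    n≤c = ≮⇒≥ c≮n
    n²<n·n+1 : n * n < n * suc n
    n²<n·n+1 = *-monoʳ-< n (n<1+n n)

  -- With N = suc c + B and c * suc c = 2 t, N² − 2t = (suc c)(1 + 2B) + B².
  square∸oblong≤ : ∀ {c t m} B → c * suc c ≡ 2 * t → t ≤ m →
                   (suc c + B) * (suc c + B) ∸ 2 * m ≤ (suc c + B) * (1 + 2 * B)
  square∸oblong≤ {c} {t} {m} B oblong≡2t t≤m = begin
    N * N ∸ 2 * m       ≤⟨ ∸-monoʳ-≤ (N * N) (*-monoʳ-≤ 2 t≤m) ⟩
    N * N ∸ 2 * t       ≡⟨ cong (_∸ 2 * t) (trans (expand c B) (cong (_+ Y) oblong≡2t)) ⟩
    2 * t + Y ∸ 2 * t   ≡⟨ m+n∸m≡n (2 * t) Y ⟩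
    Y                   ≤⟨ m≤m+n Y (B * B + B) ⟩
    Y + (B * B + B)     ≡⟨ collect c B ⟩
    N * (1 + 2 * B)     ∎
    where
    open ≤-Reasoning
    N Y : ℕ
    N = suc c + B
    Y = suc c * (1 + 2 * B) + B * B
    expand : ∀ c B → (suc c + B) * (suc c + B) ≡ c * suc c + (suc c * (1 + 2 * B) + B * B)
    expand = solve-∀
    collect : ∀ c B → suc c * (1 + 2 * B) + B * B + (B * B + B) ≡ (suc c + B) * (1 + 2 * B)
    collect = solve-∀

  odd²≤ : ∀ {c B} → B * B < 5 * c + 4 * B → (1 + 2 * B) * (1 + 2 * B) ≤ 20 * (suc c + B)
  odd²≤ {c} {B} B²<5c+4B = ≤-trans (m≤m+n _ 23) (begin
    (1 + 2 * B) * (1 + 2 * B) + 23  ≡⟨ expand B ⟩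
    4 * suc (B * B) + (4 * B + 20)  ≤⟨ +-monoˡ-≤ (4 * B + 20) (*-monoʳ-≤ 4 B²<5c+4B) ⟩
    4 * (5 * c + 4 * B) + (4 * B + 20)  ≡⟨ collect c B ⟩
    20 * (suc c + B)                ∎)
    where
    open ≤-Reasoning
    expand : ∀ B → (1 + 2 * B) * (1 + 2 * B) + 23 ≡ 4 * suc (B * B) + (4 * B + 20)
    expand = solve-∀
    collect : ∀ c B → 4 * (5 * c + 4 * B) + (4 * B + 20) ≡ 20 * (suc c + B)
    collect = solve-∀

  -- The dimension bound 81 n³ ≤ 4 (n² − 2m)² leaves enough room for the rest once
  -- the largest block fitting m has been taken: otherwise (n² − 2m)² ≤ 20 n³.
  admissible-afterLargestBlock : ∀ {c t m} B → c * suc c ≡ 2 * t → t ≤ m →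
    81 * (suc c + B) ^ 3 ≤ 4 * ((suc c + B) * (suc c + B) ∸ 2 * m) ^ 2 → Admissible B c
  admissible-afterLargestBlock {c} {t} {m} B oblong≡2t t≤m room with 5 * c + 4 * B ≤? B * B
  ... | yes adm = admissible adm
  ... | no  ¬adm = contradiction room (<⇒≱ (begin-strict
    4 * (N * N ∸ 2 * m) ^ 2                     ≤⟨ *-monoʳ-≤ 4 (^-monoˡ-≤ 2 deficit≤) ⟩
    4 * (N * (1 + 2 * B)) ^ 2                   ≡⟨ regroup N (1 + 2 * B) ⟩
    4 * (N * N) * ((1 + 2 * B) * (1 + 2 * B))   ≤⟨ *-monoʳ-≤ (4 * (N * N)) (odd²≤ {c} {B} (≰⇒> ¬adm)) ⟩
    4 * (N * N) * (20 * N)                      ≡⟨ cube N ⟩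
    80 * N ^ 3                                  <⟨ *-monoˡ-< (N ^ 3) (n<1+n 80) ⟩
    81 * N ^ 3                                  ∎))
    where
    open ≤-Reasoning
    N : ℕ
    N = suc c + B
    deficit≤ : N * N ∸ 2 * m ≤ N * (1 + 2 * B)
    deficit≤ = square∸oblong≤ {c} {t} {m} B oblong≡2t t≤m
    regroup : ∀ x y → 4 * ((x * y) * ((x * y) * 1)) ≡ 4 * (x * x) * (y * y)
    regroup = solve-∀
    cube : ∀ x → 4 * (x * x) * (20 * x) ≡ 80 * (x * (x * (x * 1)))
    cube = solve-∀

  record Partition (n v : ℕ) : Set where
    field
      parts    : List ℕ
      size≡    : size parts ≡ n
      oblongs≡ : oblongs parts ≡ v

  size-++-ones : ∀ k cs → size (replicate k 0 ++ cs) ≡ k + size cs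
  size-++-ones zero    cs = refl
  size-++-ones (suc k) cs = cong suc (size-++-ones k cs)

  oblongs-++-ones : ∀ k cs → oblongs (replicate k 0 ++ cs) ≡ oblongs cs
  oblongs-++-ones zero    cs = refl
  oblongs-++-ones (suc k) cs = oblongs-++-ones k cs

  pad : ∀ {B v} → Partition≤ B v → Partition B v
  pad {B} P = record
    { parts    = replicate k 0 ++ parts
    ; size≡    = trans (size-++-ones k parts) (m∸n+n≡m size≤)
    ; oblongs≡ = trans (oblongs-++-ones k parts) oblongs≡
    }
    where
    open Partition≤ P
    k : ℕ
    k = B ∸ size parts

  partition : ∀ n m → 1 ≤ n → 2 * m ≤ n * n → 81 * n ^ 3 ≤ 4 * (n * n ∸ 2 * m) ^ 2 →
              Partition n (2 * m)
  partition n m 1≤n 2m≤n² room = pad (prependRoot R c<n rest)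
    where
    R : TriangularRoot m
    R = triangularRoot m
    c t : ℕ
    c = root R
    t = triangle R
    c<n : suc c ≤ n
    c<n = oblong≤square⇒< 1≤n
            (≤-trans (≤-reflexive (root-oblong R)) (≤-trans (*-monoʳ-≤ 2 (triangle≤ R)) 2m≤n²))
    n≡ : n ≡ suc c + (n ∸ suc c)
    n≡ = sym (m+[n∸m]≡n c<n)
    adm : Admissible (n ∸ suc c) c
    adm = admissible-afterLargestBlock (n ∸ suc c) (root-oblong R) (triangle≤ R)
            (subst (λ N → 81 * N ^ 3 ≤ 4 * (N * N ∸ 2 * m) ^ 2) n≡ room)
    rest : Partition≤ (n ∸ suc c) (2 * (m ∸ t))
    rest = representable (n ∸ suc c) (admissible-mono (remainder≤root R) adm)

  blockSizes : (cs : List ℕ) → Fin (length cs) → ℕ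
  blockSizes cs i = suc (lookup cs i)

  ∑ℕ-blockSizes : ∀ cs → ∑ℕ (blockSizes cs) ≡ size cs
  ∑ℕ-blockSizes []       = refl
  ∑ℕ-blockSizes (c ∷ cs) = cong (suc c +_) (∑ℕ-blockSizes cs)

  ∑ℕ-blockSizes² : ∀ cs → ∑ℕ (λ i → blockSizes cs i * blockSizes cs i) ≡ size cs + oblongs cs
  ∑ℕ-blockSizes² []       = refl
  ∑ℕ-blockSizes² (c ∷ cs) =
    trans (cong (suc c * suc c +_) (∑ℕ-blockSizes² cs)) (square-split c (size cs) (oblongs cs))
    where
    square-split : ∀ c x y → suc c * suc c + (x + y) ≡ (suc c + x) + (c * suc c + y)
    square-split = solve-∀

module BlockDiagonal {c ℓ} (k : Field c ℓ) where

  open import Data.Nat as ℕ using (ℕ; zero; suc)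
  open import Data.Fin as Fin using (Fin; _↑ˡ_; _↑ʳ_; splitAt; join)
  open import Data.Fin.Properties using (join-splitAt; splitAt-↑ˡ; splitAt-↑ʳ; ↑ˡ-injective; ↑ʳ-injective)
  open import Data.Sum using (inj₁; inj₂)
  open import Data.Vec.Functional using (_++_; replicate)
  open import Data.Vec.Functional.Properties using (lookup-++ˡ; lookup-++ʳ)
  open import Function using (_∘_)
  open import Relation.Binary.PropositionalEquality as ≡ using (_≡_; _≢_; ≢-sym)
  open import Relation.Nullary using (yes; no; contradiction)
  import Algebra.Properties.Monoid.Sum as MonoidSum

  open Field k
  open MatrixAlgebra k
  open MonoidSum +-monoid using (sum; sum-cong-≗; sum-cong-≋; sum-replicate-zero)

  ≈-resp-≡ : ∀ {x x′ y y′} → x ≡ x′ → y ≡ y′ → x′ ≈ y′ → x ≈ y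
  ≈-resp-≡ ≡.refl ≡.refl x′≈y′ = x′≈y′

  ≈M-refl : ∀ {n} {A : Mat n} → A ≈M A
  ≈M-refl i j = refl

  ≈M-trans : ∀ {n} {A B C : Mat n} → A ≈M B → B ≈M C → A ≈M C
  ≈M-trans A≈B B≈C i j = trans (A≈B i j) (B≈C i j)

  sum-split : ∀ p q (f : Fin (p ℕ.+ q) → Carrier) →
              sum f ≈ sum (f ∘ (_↑ˡ q)) + sum (f ∘ (p ↑ʳ_))
  sum-split zero    q f = sym (+-identityˡ _)
  sum-split (suc p) q f = trans (+-congˡ (sum-split p q (f ∘ Fin.suc))) (sym (+-assoc _ _ _))

  _⊕_ : ∀ {p q} → Mat p → Mat q → Mat (p ℕ.+ q)
  _⊕_ {p} {q} A B = (λ i → A i ++ replicate q 0#) ++ (λ i → replicate p 0# ++ B i)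

  module _ {p q} (A : Mat p) (B : Mat q) where
    private
      top : Fin p → Fin (p ℕ.+ q) → Carrier
      top i = A i ++ replicate q 0#
      bottom : Fin q → Fin (p ℕ.+ q) → Carrier
      bottom i = replicate p 0# ++ B i

    ⊕-topLeft : ∀ i j → (A ⊕ B) (i ↑ˡ q) (j ↑ˡ q) ≡ A i j
    ⊕-topLeft i j =
      ≡.trans (≡.cong-app (lookup-++ˡ top bottom i) (j ↑ˡ q)) (lookup-++ˡ (A i) (replicate q 0#) j)

    ⊕-topRight : ∀ i j → (A ⊕ B) (i ↑ˡ q) (p ↑ʳ j) ≡ 0#
    ⊕-topRight i j =
      ≡.trans (≡.cong-app (lookup-++ˡ top bottom i) (p ↑ʳ j)) (lookup-++ʳ (A i) (replicate q 0#) j)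

    ⊕-bottomLeft : ∀ i j → (A ⊕ B) (p ↑ʳ i) (j ↑ˡ q) ≡ 0#
    ⊕-bottomLeft i j =
      ≡.trans (≡.cong-app (lookup-++ʳ top bottom i) (j ↑ˡ q)) (lookup-++ˡ (replicate p 0#) (B i) j)

    ⊕-bottomRight : ∀ i j → (A ⊕ B) (p ↑ʳ i) (p ↑ʳ j) ≡ B i j
    ⊕-bottomRight i j =
      ≡.trans (≡.cong-app (lookup-++ʳ top bottom i) (p ↑ʳ j)) (lookup-++ʳ (replicate p 0#) (B i) j)

  ≈M-blockwise : ∀ {p q} {X Y : Mat (p ℕ.+ q)} →
    (∀ i j → X (i ↑ˡ q) (j ↑ˡ q) ≈ Y (i ↑ˡ q) (j ↑ˡ q)) →
    (∀ i j → X (i ↑ˡ q) (p ↑ʳ j) ≈ Y (i ↑ˡ q) (p ↑ʳ j)) →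
    (∀ i j → X (p ↑ʳ i) (j ↑ˡ q) ≈ Y (p ↑ʳ i) (j ↑ˡ q)) →
    (∀ i j → X (p ↑ʳ i) (p ↑ʳ j) ≈ Y (p ↑ʳ i) (p ↑ʳ j)) → X ≈M Y
  ≈M-blockwise {p} {q} {X} {Y} tl tr bl br i j =
    ≡.subst₂ (λ i j → X i j ≈ Y i j) (join-splitAt p q i) (join-splitAt p q j)
             (joined (splitAt p i) (splitAt p j))
    where
    joined : ∀ x y → X (join p q x) (join p q y) ≈ Y (join p q x) (join p q y)
    joined (inj₁ i) (inj₁ j) = tl i j
    joined (inj₁ i) (inj₂ j) = tr i j
    joined (inj₂ i) (inj₁ j) = bl i j
    joined (inj₂ i) (inj₂ j) = br i j

  ⊕-cong : ∀ {p q} {A A′ : Mat p} {B B′ : Mat q} →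
           A ≈M A′ → B ≈M B′ → (A ⊕ B) ≈M (A′ ⊕ B′)
  ⊕-cong {A = A} {A′} {B} {B′} A≈A′ B≈B′ = ≈M-blockwise
    (λ i j → ≈-resp-≡ (⊕-topLeft A B i j) (⊕-topLeft A′ B′ i j) (A≈A′ i j))
    (λ i j → ≈-resp-≡ (⊕-topRight A B i j) (⊕-topRight A′ B′ i j) refl)
    (λ i j → ≈-resp-≡ (⊕-bottomLeft A B i j) (⊕-bottomLeft A′ B′ i j) refl)
    (λ i j → ≈-resp-≡ (⊕-bottomRight A B i j) (⊕-bottomRight A′ B′ i j) (B≈B′ i j))

  ⊕-injectiveˡ : ∀ {p q} {A A′ : Mat p} {B B′ : Mat q} → (A ⊕ B) ≈M (A′ ⊕ B′) → A ≈M A′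
  ⊕-injectiveˡ {q = q} {A} {A′} {B} {B′} eq i j =
    ≈-resp-≡ (≡.sym (⊕-topLeft A B i j)) (≡.sym (⊕-topLeft A′ B′ i j)) (eq (i ↑ˡ q) (j ↑ˡ q))

  ⊕-injectiveʳ : ∀ {p q} {A A′ : Mat p} {B B′ : Mat q} → (A ⊕ B) ≈M (A′ ⊕ B′) → B ≈M B′
  ⊕-injectiveʳ {p} {A = A} {A′} {B} {B′} eq i j =
    ≈-resp-≡ (≡.sym (⊕-bottomRight A B i j)) (≡.sym (⊕-bottomRight A′ B′ i j)) (eq (p ↑ʳ i) (p ↑ʳ j))

  ⊕-zipWith : ∀ {p q} (f : Carrier → Carrier → Carrier) → f 0# 0# ≈ 0# →
              (A A′ : Mat p) (B B′ : Mat q) →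
              ((λ i j → f (A i j) (A′ i j)) ⊕ (λ i j → f (B i j) (B′ i j)))
                ≈M (λ i j → f ((A ⊕ B) i j) ((A′ ⊕ B′) i j))
  ⊕-zipWith f f00≈0 A A′ B B′ = ≈M-blockwise
    (λ i j → ≈-resp-≡ (⊕-topLeft C D i j)
                      (≡.cong₂ f (⊕-topLeft A B i j) (⊕-topLeft A′ B′ i j)) refl)
    (λ i j → ≈-resp-≡ (⊕-topRight C D i j)
                      (≡.cong₂ f (⊕-topRight A B i j) (⊕-topRight A′ B′ i j)) (sym f00≈0))
    (λ i j → ≈-resp-≡ (⊕-bottomLeft C D i j)
                      (≡.cong₂ f (⊕-bottomLeft A B i j) (⊕-bottomLeft A′ B′ i j)) (sym f00≈0))
    (λ i j → ≈-resp-≡ (⊕-bottomRight C D i j)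
                      (≡.cong₂ f (⊕-bottomRight A B i j) (⊕-bottomRight A′ B′ i j)) refl)
    where
    C : Mat _
    C i j = f (A i j) (A′ i j)
    D : Mat _
    D i j = f (B i j) (B′ i j)

  ⊕-+ : ∀ {p q} (A A′ : Mat p) (B B′ : Mat q) →
        ((A +M A′) ⊕ (B +M B′)) ≈M ((A ⊕ B) +M (A′ ⊕ B′))
  ⊕-+ = ⊕-zipWith _+_ (+-identityˡ 0#)

  ⊕-· : ∀ {p q} a (A : Mat p) (B : Mat q) → ((a ·M A) ⊕ (a ·M B)) ≈M (a ·M (A ⊕ B))
  ⊕-· a A B = ⊕-zipWith (λ _ y → a * y) (zeroʳ a) A A B B

  sum-cong-* : ∀ {n} {f f′ g g′ : Fin n → Carrier} → (∀ l → f l ≡ g l) → (∀ l → f′ l ≡ g′ l) →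
               sum (λ l → f l * f′ l) ≈ sum (λ l → g l * g′ l)
  sum-cong-* f≡g f′≡g′ = reflexive (sum-cong-≗ (λ l → ≡.cong₂ _*_ (f≡g l) (f′≡g′ l)))

  sum-0* : ∀ {n} {f g : Fin n → Carrier} → (∀ l → f l ≡ 0#) → sum (λ l → f l * g l) ≈ 0#
  sum-0* {n} f≡0 = trans (sum-cong-≋ (λ l → trans (reflexive (≡.cong (_* _) (f≡0 l))) (zeroˡ _)))
                         (sum-replicate-zero n)

  sum-*0 : ∀ {n} {f g : Fin n → Carrier} → (∀ l → g l ≡ 0#) → sum (λ l → f l * g l) ≈ 0#
  sum-*0 {n} g≡0 = trans (sum-cong-≋ (λ l → trans (reflexive (≡.cong (_ *_) (g≡0 l))) (zeroʳ _)))
                         (sum-replicate-zero n)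

  ⊕-* : ∀ {p q} (A A′ : Mat p) (B B′ : Mat q) →
        ((A *M A′) ⊕ (B *M B′)) ≈M ((A ⊕ B) *M (A′ ⊕ B′))
  ⊕-* {p} {q} A A′ B B′ = ≈M-blockwise
    (λ i j → ≈-resp-≡ (⊕-topLeft (A *M A′) (B *M B′) i j) ≡.refl (sym (trans
      (split (i ↑ˡ q) (j ↑ˡ q) (sum-cong-* (⊕-topLeft A B i) (λ l → ⊕-topLeft A′ B′ l j))
                               (sum-0* (⊕-topRight A B i)))
      (+-identityʳ _))))
    (λ i j → ≈-resp-≡ (⊕-topRight (A *M A′) (B *M B′) i j) ≡.refl (sym (trans
      (split (i ↑ˡ q) (p ↑ʳ j) (sum-*0 (λ l → ⊕-topRight A′ B′ l j)) (sum-0* (⊕-topRight A B i)))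
      (+-identityˡ 0#))))
    (λ i j → ≈-resp-≡ (⊕-bottomLeft (A *M A′) (B *M B′) i j) ≡.refl (sym (trans
      (split (p ↑ʳ i) (j ↑ˡ q) (sum-0* (⊕-bottomLeft A B i)) (sum-*0 (λ l → ⊕-bottomLeft A′ B′ l j)))
      (+-identityˡ 0#))))
    (λ i j → ≈-resp-≡ (⊕-bottomRight (A *M A′) (B *M B′) i j) ≡.refl (sym (trans
      (split (p ↑ʳ i) (p ↑ʳ j) (sum-0* (⊕-bottomLeft A B i))
                               (sum-cong-* (⊕-bottomRight A B i) (λ l → ⊕-bottomRight A′ B′ l j)))
      (+-identityˡ _))))
    where
    split : ∀ x y {a b} →
            sum (λ l → (A ⊕ B) x (l ↑ˡ q) * (A′ ⊕ B′) (l ↑ˡ q) y) ≈ a →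
            sum (λ l → (A ⊕ B) x (p ↑ʳ l) * (A′ ⊕ B′) (p ↑ʳ l) y) ≈ b →
            ((A ⊕ B) *M (A′ ⊕ B′)) x y ≈ a + b
    split x y ≈a ≈b = trans (sum-split p q _) (+-cong ≈a ≈b)

  1M-≢ : ∀ {n} {i j : Fin n} → i ≢ j → 1M i j ≡ 0#
  1M-≢ {i = i} {j} i≢j with i Fin.≟ j
  ... | yes i≡j = contradiction i≡j i≢j
  ... | no  _   = ≡.refl

  1M-reindex : ∀ {a b} (f : Fin a → Fin b) → (∀ {i j} → f i ≡ f j → i ≡ j) →
               ∀ i j → 1M (f i) (f j) ≡ 1M i j
  1M-reindex f f-injective i j with i Fin.≟ j | f i Fin.≟ f j
  ... | yes _      | yes _     = ≡.refl
  ... | no  _      | no  _     = ≡.refl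
  ... | yes ≡.refl | no  fi≢fj = contradiction ≡.refl fi≢fj
  ... | no  i≢j    | yes fi≡fj = contradiction (f-injective fi≡fj) i≢j

  ↑ˡ≢↑ʳ : ∀ {p q} (i : Fin p) (j : Fin q) → i ↑ˡ q ≢ p ↑ʳ j
  ↑ˡ≢↑ʳ {p} {q} i j eq
    with ≡.trans (≡.sym (splitAt-↑ˡ p i q)) (≡.trans (≡.cong (splitAt p) eq) (splitAt-↑ʳ p q j))
  ... | ()

  ⊕-1 : ∀ {p q} → (1M {p} ⊕ 1M {q}) ≈M 1M
  ⊕-1 {p} {q} = ≈M-blockwise
    (λ i j → ≈-resp-≡ (⊕-topLeft I I′ i j) (1M-reindex (_↑ˡ q) (↑ˡ-injective q _ _) i j) refl)
    (λ i j → ≈-resp-≡ (⊕-topRight I I′ i j) (1M-≢ (↑ˡ≢↑ʳ i j)) refl)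
    (λ i j → ≈-resp-≡ (⊕-bottomLeft I I′ i j) (1M-≢ (≢-sym (↑ˡ≢↑ʳ j i))) refl)
    (λ i j → ≈-resp-≡ (⊕-bottomRight I I′ i j) (1M-reindex (p ↑ʳ_) (↑ʳ-injective p _ _) i j) refl)
    where
    I : Mat p
    I = 1M
    I′ : Mat q
    I′ = 1M

  blockDiagonal : ∀ {t} (ns : Fin t → ℕ) → DSum ns → Mat (∑ℕ ns)
  blockDiagonal {zero}  ns x = λ ()
  blockDiagonal {suc t} ns x = x Fin.zero ⊕ blockDiagonal (ns ∘ Fin.suc) (x ∘ Fin.suc)

  blockDiagonal-isEmbedding : ∀ {t} (ns : Fin t → ℕ) → IsAlgebraEmbedding ns (blockDiagonal ns)
  blockDiagonal-isEmbedding {zero} ns = record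
    { cong = λ _ _ _ () ; injective = λ _ _ _ () ; hom-+ = λ _ _ () ; hom-· = λ _ _ ()
    ; hom-* = λ _ _ () ; hom-1 = λ () }
  blockDiagonal-isEmbedding {suc t} ns = record
    { cong      = λ x y x≈y → ⊕-cong (x≈y Fin.zero) (IH.cong _ _ (x≈y ∘ Fin.suc))
    ; injective = λ x y φx≈φy → λ
        { Fin.zero    → ⊕-injectiveˡ φx≈φy
        ; (Fin.suc i) → IH.injective _ _ (⊕-injectiveʳ φx≈φy) i }
    ; hom-+ = λ x y → ≈M-trans (⊕-cong ≈M-refl (IH.hom-+ _ _)) (⊕-+ (x Fin.zero) (y Fin.zero) _ _)
    ; hom-· = λ a x → ≈M-trans (⊕-cong ≈M-refl (IH.hom-· a _)) (⊕-· a (x Fin.zero) _)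
    ; hom-* = λ x y → ≈M-trans (⊕-cong ≈M-refl (IH.hom-* _ _)) (⊕-* (x Fin.zero) (y Fin.zero) _ _)
    ; hom-1 = ≈M-trans (⊕-cong ≈M-refl IH.hom-1) (⊕-1 {ns Fin.zero})
    }
    where
    module IH = IsAlgebraEmbedding (blockDiagonal-isEmbedding (ns ∘ Fin.suc))

  directSum-CSA : ∀ {t} (ns : Fin t → ℕ) → (∀ i → 1 ℕ.≤ ns i) → ∀ {n d} →
                  ∑ℕ ns ≡ n → ∑ℕ (λ i → ns i ℕ.* ns i) ≡ d → CSA n d
  directSum-CSA {t} ns positive ≡.refl dim = record
    { t = t ; sizes = ns ; positive = positive ; sum-n = ≡.refl ; dim-d = dim
    ; embed = blockDiagonal ns ; isEmbed = blockDiagonal-isEmbedding ns }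

open import Data.Nat using (ℕ; _≤_; _+_; _*_; _^_; _∸_; s≤s; z≤n)
open import Data.Nat.Properties using (≤-trans)
open import Relation.Binary.PropositionalEquality using (trans; cong₂)
open BlockPartition using (Partition; partition; blockSizes; ∑ℕ-blockSizes; ∑ℕ-blockSizes²)

theorem5 : ∀ {c ℓ : Level} (k : Field c ℓ) (n m : ℕ) →
           225 ≤ n →
           2 * m ≤ n * n →
           81 * n ^ 3 ≤ 4 * (n * n ∸ 2 * m) ^ 2 →
           MatrixAlgebra.CSA k n (n + 2 * m)
theorem5 k n m 225≤n 2m≤n² room =
  BlockDiagonal.directSum-CSA k (blockSizes parts) (λ _ → s≤s z≤n)
    (trans (∑ℕ-blockSizes parts) size≡)
    (trans (∑ℕ-blockSizes² parts) (cong₂ _+_ size≡ oblongs≡))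
  where
  open Partition (partition n m (≤-trans (s≤s z≤n) 225≤n) 2m≤n² room)
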